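{- Let $s$ and $t$ be symbolic trees with edge colours in a finite set $\Sigma$ and variables in a finite set $X$. If $s\neq t$, then for every integer $N$ there is $\bar a\in\mathbb Z^X$ with all entries larger than $N$ such that $s(\bar a)\neq t(\bar a)$.
   Context: The set of symbolic trees with edge colours in $\Sigma$ and variables $X$ is the least set $T$ such that $T$ contains all finite formal linear combinations of elements of $\Sigma\times T$ with coefficients in the polynomial ring $\mathbb Z[X]$ (the zero combination is the root-only tree). Intuitively a symbolic tree is a tree whose edges carry a colour and a polynomial; two symbolic trees are equal when they are equal as formal linear combinations. For $\bar a\in\mathbb Z^X$, $s(\bar a)$ denotes the weighted tree (symbolic tree with no variables, i.e.\ with integer coefficients) obtained by substituting $\bar a$ into every polynomial of $s$. -}

module Defs where

open import Data.Nat using (ℕ)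
open import Data.Integer using (ℤ; _+_; _*_; _^_; +_)
open import Data.Fin using (Fin)
open import Data.Vec using (Vec; []; _∷_; lookup)
import Data.Nat.Properties as ℕₚ
open import Data.Vec.Properties using (≡-dec)
open import Data.List using (List; []; _∷_)
open import Data.Product using (_×_; _,_)
open import Relation.Binary.PropositionalEquality using (_≡_)
open import Relation.Nullary using (yes; no)

-- Polynomials ℤ[X] with X = Fin k: finite formal ℤ-linear combinations
-- of monomials (exponent vectors), given as a list of (monomial, coeff).

Monomial : ℕ → Set
Monomial k = Vec ℕ k

Poly : ℕ → Set
Poly k = List (Monomial k × ℤ)

coeff : ∀ {k} → Poly k → Monomial k → ℤ
coeff [] m = + 0
coeff ((m′ , z) ∷ p) m with ≡-dec ℕₚ._≟_ m′ m
... | yes _ = z + coeff p m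
... | no  _ = coeff p m

_≈ₚ_ : ∀ {k} → Poly k → Poly k → Set
p ≈ₚ q = ∀ m → coeff p m ≡ coeff q m

0ₚ : ∀ {k} → Poly k
0ₚ = []

_+ₚ_ : ∀ {k} → Poly k → Poly k → Poly k
[] +ₚ q = q
(x ∷ p) +ₚ q = x ∷ (p +ₚ q)

evalMon : ∀ {k} → Monomial k → (Fin k → ℤ) → ℤ
evalMon [] a = + 1
evalMon (e ∷ m) a = (a Fin.zero ^ e) * evalMon m (λ i → a (Fin.suc i))
  where import Data.Fin as Fin

evalPoly : ∀ {k} → Poly k → (Fin k → ℤ) → ℤ
evalPoly [] a = + 0
evalPoly ((m , z) ∷ p) a = z * evalMon m a + evalPoly p a

const : ℤ → Poly 0
const z = ([] , z) ∷ []

-- Symbolic trees with edge colours in Σ = Fin c and variables X = Fin k: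
-- finite formal ℤ[X]-linear combinations of elements of Σ × T,
-- presented as lists of (colour, coefficient, subtree).
-- The empty list is the root-only tree.

data Tree (c k : ℕ) : Set where
  node : List (Fin c × Poly k × Tree c k) → Tree c k

-- Equality of symbolic trees as formal linear combinations: the least
-- congruence identifying a list of terms with the element of the free
-- ℤ[X]-module on Σ × T it denotes.
infix 4 _≈ₜ_ _≈ₗ_
data _≈ₜ_ {c k : ℕ} : Tree c k → Tree c k → Set
data _≈ₗ_ {c k : ℕ} : List (Fin c × Poly k × Tree c k) →
                      List (Fin c × Poly k × Tree c k) → Set

data _≈ₜ_ {c} {k} where
  node≈ : ∀ {l l′} → l ≈ₗ l′ → node l ≈ₜ node l′

data _≈ₗ_ {c} {k} where
  ≈-refl  : ∀ {l} → l ≈ₗ l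
  ≈-sym   : ∀ {l l′} → l ≈ₗ l′ → l′ ≈ₗ l
  ≈-trans : ∀ {l l′ l″} → l ≈ₗ l′ → l′ ≈ₗ l″ → l ≈ₗ l″
  ≈-cons  : ∀ {σ p p′ u u′ l l′} → p ≈ₚ p′ → u ≈ₜ u′ → l ≈ₗ l′ →
            ((σ , p , u) ∷ l) ≈ₗ ((σ , p′ , u′) ∷ l′)
  ≈-swap  : ∀ {x y l} → (x ∷ y ∷ l) ≈ₗ (y ∷ x ∷ l)
  ≈-merge : ∀ {σ p q u l} →
            ((σ , p , u) ∷ (σ , q , u) ∷ l) ≈ₗ ((σ , p +ₚ q , u) ∷ l)
  ≈-zero  : ∀ {σ u l} → ((σ , 0ₚ , u) ∷ l) ≈ₗ l

-- Substitution s(ā): a weighted tree = symbolic tree with no variables.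

evalTree : ∀ {c k} → Tree c k → (Fin k → ℤ) → Tree c 0
evalList : ∀ {c k} → List (Fin c × Poly k × Tree c k) → (Fin k → ℤ) →
           List (Fin c × Poly 0 × Tree c 0)
evalTree (node l) a = node (evalList l a)
evalList [] a = []
evalList ((σ , p , u) ∷ l) a = (σ , const (evalPoly p a) , evalTree u a) ∷ evalList l a

-- Evaluation respects equivalence, so it is enough to show that any two symbolic trees are either
-- equivalent or separated: inequivalent at all sufficiently large ā, in the iterated sense of
-- Eventually.  This dichotomy is proved by induction on height, and it is what makes the theorem
-- provable constructively from a mere ¬ (s ≈ₜ t).  For two nodes, take a term x and compare the
-- total coefficients of its class (same colour, equivalent subtree) on both sides.  If they agree,
-- remove the class from both sides and recurse.  If they differ, their difference is a nonzero
-- polynomial, hence nonzero at all large ā; taking ā large enough also keeps the subtrees separated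
-- from x's subtree inequivalent after evaluation, so the evaluated class has different total
-- coefficients on the two sides, while this total is an invariant of ≈ₗ.
module Submission where

open import Defs
open import Data.Nat as ℕ using (ℕ; zero; suc)
import Data.Nat.Properties as ℕₚ
open import Data.Integer as ℤ using (ℤ; +_; _+_; _*_; -_; _-_; _^_; ∣_∣; _<_; _⊔_)
open import Data.Integer.Base using () renaming (suc to sucℤ)
import Data.Integer.Properties as ℤₚ
open import Data.Integer.Tactic.RingSolver using (solve-∀)
open import Data.Fin using (Fin; zero; suc)
import Data.Fin.Properties as Finₚ
open import Data.Vec using ([]; _∷_)
open import Data.Vec.Properties using (≡-dec; ∷-injectiveˡ; ∷-injectiveʳ)
open import Data.Vec.Functional using () renaming (_∷_ to _∷ᶠ_)
open import Data.List as List using (List; []; _∷_; _++_; length)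
open import Data.List.Membership.Propositional using (_∈_; _∉_)
open import Data.List.Membership.Propositional.Properties using (∈-++⁺ˡ; ∈-++⁺ʳ; ∈-deduplicate⁺)
open import Data.List.Relation.Unary.Any using (here; there)
import Data.List.Relation.Unary.Any as Any
open import Data.List.Relation.Unary.All as All using (All; []; _∷_)
open import Data.List.Relation.Unary.All.Properties using (¬All⇒Any¬)
open import Data.List.Relation.Unary.Unique.Propositional using (Unique)
open import Data.List.Relation.Unary.AllPairs using ([]; _∷_)
open import Data.List.Relation.Unary.Unique.DecPropositional.Properties using (deduplicate-!)
open import Data.Product using (Σ; ∃-syntax; _×_; _,_; proj₁; map₂)
open import Data.Sum using (_⊎_; inj₁; inj₂)
open import Data.Unit using (⊤; tt)
open import Data.Empty using (⊥-elim)
open import Relation.Nullary using (¬_; yes; no; Dec)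
open import Relation.Nullary.Decidable using (¬¬-excluded-middle; decidable-stable)
open import Relation.Nullary.Negation using (¬¬-Monad)
open import Effect.Monad using (RawMonad)
open import Level using (0ℓ)
open import Relation.Binary.Definitions using (DecidableEquality)
open import Function using (_∘_)
open import Relation.Binary.PropositionalEquality

-- Polynomials

_≟ᵐ_ : ∀ {k} → DecidableEquality (Monomial k)
_≟ᵐ_ = ≡-dec ℕₚ._≟_

_≉ₚ_ : ∀ {k} → Poly k → Poly k → Set
p ≉ₚ q = ∃[ m ] coeff p m ≢ coeff q m

coeff-+ₚ : ∀ {k} (p q : Poly k) m → coeff (p +ₚ q) m ≡ coeff p m + coeff q m
coeff-+ₚ [] q m = sym (ℤₚ.+-identityˡ _)
coeff-+ₚ ((m′ , z) ∷ p) q m with m′ ≟ᵐ m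
... | yes _ = trans (cong (_+_ z) (coeff-+ₚ p q m)) (sym (ℤₚ.+-assoc z _ _))
... | no _  = coeff-+ₚ p q m

evalPoly-+ₚ : ∀ {k} (p q : Poly k) a → evalPoly (p +ₚ q) a ≡ evalPoly p a + evalPoly q a
evalPoly-+ₚ [] q a = sym (ℤₚ.+-identityˡ _)
evalPoly-+ₚ ((m , z) ∷ p) q a =
  trans (cong (_+_ (z * evalMon m a)) (evalPoly-+ₚ p q a)) (sym (ℤₚ.+-assoc (z * evalMon m a) _ _))

negₚ : ∀ {k} → Poly k → Poly k
negₚ = List.map (map₂ (λ z → - z))

_-ₚ_ : ∀ {k} → Poly k → Poly k → Poly k
p -ₚ q = p +ₚ negₚ q

coeff-negₚ : ∀ {k} (p : Poly k) m → coeff (negₚ p) m ≡ - coeff p m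
coeff-negₚ [] m = refl
coeff-negₚ ((m′ , z) ∷ p) m with m′ ≟ᵐ m
... | yes _ = trans (cong (_+_ (- z)) (coeff-negₚ p m)) (sym (ℤₚ.neg-distrib-+ z _))
... | no _  = coeff-negₚ p m

evalPoly-negₚ : ∀ {k} (p : Poly k) a → evalPoly (negₚ p) a ≡ - evalPoly p a
evalPoly-negₚ [] a = refl
evalPoly-negₚ ((m , z) ∷ p) a =
  trans (cong (_+_ (- z * evalMon m a)) (evalPoly-negₚ p a)) (neg-distrib z (evalMon m a) (evalPoly p a))
  where
  neg-distrib : ∀ z e r → - z * e + - r ≡ - (z * e + r)
  neg-distrib = solve-∀

coeff-subₚ : ∀ {k} (p q : Poly k) m → coeff (p -ₚ q) m ≡ coeff p m - coeff q m
coeff-subₚ p q m = trans (coeff-+ₚ p (negₚ q) m) (cong (_+_ (coeff p m)) (coeff-negₚ q m))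

evalPoly-subₚ : ∀ {k} (p q : Poly k) a → evalPoly (p -ₚ q) a ≡ evalPoly p a - evalPoly q a
evalPoly-subₚ p q a = trans (evalPoly-+ₚ p (negₚ q) a) (cong (_+_ (evalPoly p a)) (evalPoly-negₚ q a))

support : ∀ {k} → Poly k → List (Monomial k)
support = List.map proj₁

coeff-∉support : ∀ {k} (p : Poly k) {m} → m ∉ support p → coeff p m ≡ + 0
coeff-∉support [] m∉ = refl
coeff-∉support ((m′ , z) ∷ p) {m} m∉ with m′ ≟ᵐ m
... | yes m′≡m = ⊥-elim (m∉ (here (sym m′≡m)))
... | no _     = coeff-∉support p (λ m∈ → m∉ (there m∈))

≈ₚ-or-≉ₚ : ∀ {k} (p q : Poly k) → p ≈ₚ q ⊎ p ≉ₚ q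
≈ₚ-or-≉ₚ p q with All.all? (λ m → coeff p m ℤ.≟ coeff q m) (support p ++ support q)
... | no ¬all = inj₂ (Any.satisfied (¬All⇒Any¬ (λ m → coeff p m ℤ.≟ coeff q m) _ ¬all))
... | yes all = inj₁ agree
  where
  agree : p ≈ₚ q
  agree m with Any.any? (m ≟ᵐ_) (support p ++ support q)
  ... | yes m∈ = All.lookup all m∈
  ... | no m∉  = trans (coeff-∉support p (λ m∈ → m∉ (∈-++⁺ˡ m∈)))
                       (sym (coeff-∉support q (λ m∈ → m∉ (∈-++⁺ʳ (support p) m∈))))

∑ : {A : Set} → List A → (A → ℤ) → ℤ
∑ [] f = + 0
∑ (x ∷ xs) f = f x + ∑ xs f

∑-cong : {A : Set} (xs : List A) {f g : A → ℤ} → (∀ x → f x ≡ g x) → ∑ xs f ≡ ∑ xs g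
∑-cong [] f≡g = refl
∑-cong (x ∷ xs) f≡g = cong₂ _+_ (f≡g x) (∑-cong xs f≡g)

∑-+ : {A : Set} (xs : List A) (f g : A → ℤ) → ∑ xs (λ x → f x + g x) ≡ ∑ xs f + ∑ xs g
∑-+ [] f g = refl
∑-+ (x ∷ xs) f g = trans (cong (_+_ (f x + g x)) (∑-+ xs f g)) (interchange (f x) (g x) _ _)
  where
  interchange : ∀ a b c d → (a + b) + (c + d) ≡ (a + c) + (b + d)
  interchange = solve-∀

∑-vanishing : {A : Set} {xs : List A} {f : A → ℤ} → All (λ x → f x ≡ + 0) xs → ∑ xs f ≡ + 0
∑-vanishing [] = refl
∑-vanishing (fx≡0 ∷ fxs≡0) = cong₂ _+_ fx≡0 (∑-vanishing fxs≡0)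

∑-single : {A : Set} {xs : List A} {y : A} (f : A → ℤ) → Unique xs → y ∈ xs →
           (∀ x → x ≢ y → f x ≡ + 0) → ∑ xs f ≡ f y
∑-single f (y∉xs ∷ _) (here refl) vanish =
  trans (cong (_+_ (f _)) (∑-vanishing (All.map (λ y≢x → vanish _ (y≢x ∘ sym)) y∉xs))) (ℤₚ.+-identityʳ _)
∑-single f (x∉xs ∷ unique) (there y∈xs) vanish =
  trans (cong₂ _+_ (vanish _ (All.lookup x∉xs y∈xs)) (∑-single f unique y∈xs vanish)) (ℤₚ.+-identityˡ _)

coeff-∷ : ∀ {k} m′ z (p : Poly k) m → coeff ((m′ , z) ∷ p) m ≡ coeff ((m′ , z) ∷ []) m + coeff p m
coeff-∷ m′ z p m with m′ ≟ᵐ m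
... | yes _ = cong (_+ coeff p m) (sym (ℤₚ.+-identityʳ z))
... | no _  = sym (ℤₚ.+-identityˡ _)

evalPoly-as-∑ : ∀ {k} (p : Poly k) {S} a → Unique S → (∀ {m} → m ∈ support p → m ∈ S) →
                evalPoly p a ≡ ∑ S (λ m → coeff p m * evalMon m a)
evalPoly-as-∑ [] {S} a _ _ =
  sym (trans (∑-cong S (λ m → ℤₚ.*-zeroˡ (evalMon m a))) (∑-vanishing (All.universal (λ _ → refl) S)))
evalPoly-as-∑ ((m′ , z) ∷ p) {S} a unique ⊆S = sym (begin
  ∑ S (λ m → coeff ((m′ , z) ∷ p) m * E m)
    ≡⟨ ∑-cong S (λ m → trans (cong (_* E m) (coeff-∷ m′ z p m))
                             (ℤₚ.*-distribʳ-+ (E m) (coeff ((m′ , z) ∷ []) m) (coeff p m))) ⟩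
  ∑ S (λ m → coeff ((m′ , z) ∷ []) m * E m + coeff p m * E m)
    ≡⟨ ∑-+ S _ _ ⟩
  ∑ S (λ m → coeff ((m′ , z) ∷ []) m * E m) + ∑ S (λ m → coeff p m * E m)
    ≡⟨ cong₂ _+_ (∑-single _ unique (⊆S (here refl)) term-vanishes)
                 (sym (evalPoly-as-∑ p a unique (⊆S ∘ there))) ⟩
  coeff ((m′ , z) ∷ []) m′ * E m′ + evalPoly p a
    ≡⟨ cong (λ w → w * E m′ + evalPoly p a) term-at ⟩
  z * E m′ + evalPoly p a ∎)
  where
  open ≡-Reasoning
  E : Monomial _ → ℤ
  E m = evalMon m a
  term-at : coeff ((m′ , z) ∷ []) m′ ≡ z
  term-at with m′ ≟ᵐ m′
  ... | yes _    = ℤₚ.+-identityʳ z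
  ... | no m′≢m′ = ⊥-elim (m′≢m′ refl)
  term-vanishes : ∀ m → m ≢ m′ → coeff ((m′ , z) ∷ []) m * E m ≡ + 0
  term-vanishes m m≢m′ with m′ ≟ᵐ m
  ... | yes m′≡m = ⊥-elim (m≢m′ (sym m′≡m))
  ... | no _ = ℤₚ.*-zeroˡ (E m)

evalPoly-cong : ∀ {k} {p q : Poly k} → p ≈ₚ q → ∀ a → evalPoly p a ≡ evalPoly q a
evalPoly-cong {p = p} {q} p≈q a = begin
  evalPoly p a                          ≡⟨ evalPoly-as-∑ p a unique (⊆S ∘ ∈-++⁺ˡ) ⟩
  ∑ S (λ m → coeff p m * evalMon m a)   ≡⟨ ∑-cong S (λ m → cong (_* evalMon m a) (p≈q m)) ⟩
  ∑ S (λ m → coeff q m * evalMon m a)   ≡⟨ evalPoly-as-∑ q a unique (⊆S ∘ ∈-++⁺ʳ (support p)) ⟨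
  evalPoly q a                          ∎
  where
  open ≡-Reasoning
  S = List.deduplicate _≟ᵐ_ (support p ++ support q)
  unique : Unique S
  unique = deduplicate-! _≟ᵐ_ _
  ⊆S : ∀ {m} → m ∈ support p ++ support q → m ∈ S
  ⊆S = ∈-deduplicate⁺ _≟ᵐ_

-- Large arguments

-- The bound for each coordinate may depend on the values already chosen for the earlier ones.
Eventually : (k : ℕ) → ((Fin k → ℤ) → Set) → Set
Eventually zero G = G (λ ())
Eventually (suc k) G = ∃[ M ] ∀ x → M < x → Eventually k (λ a → G (x ∷ᶠ a))

Eventually-map : ∀ k {G H : (Fin k → ℤ) → Set} → (∀ a → G a → H a) → Eventually k G → Eventually k H
Eventually-map zero G⇒H g = G⇒H _ g
Eventually-map (suc k) G⇒H (M , g) = M , λ x M<x → Eventually-map k (λ a → G⇒H (x ∷ᶠ a)) (g x M<x)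

Eventually-always : ∀ k {G : (Fin k → ℤ) → Set} → (∀ a → G a) → Eventually k G
Eventually-always zero g = g _
Eventually-always (suc k) g = + 0 , λ x _ → Eventually-always k (λ a → g (x ∷ᶠ a))

Eventually-× : ∀ k {G H : (Fin k → ℤ) → Set} → Eventually k G → Eventually k H → Eventually k (λ a → G a × H a)
Eventually-× zero g h = g , h
Eventually-× (suc k) (M , g) (M′ , h) = M ⊔ M′ , λ x M⊔M′<x →
  Eventually-× k (g x (ℤₚ.≤-<-trans (ℤₚ.i≤i⊔j M M′) M⊔M′<x)) (h x (ℤₚ.≤-<-trans (ℤₚ.i≤j⊔i M M′) M⊔M′<x))

Eventually-All : ∀ k {A : Set} {G : A → (Fin k → ℤ) → Set} →
                 (∀ x → Eventually k (G x)) → ∀ xs → Eventually k (λ a → All (λ x → G x a) xs)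
Eventually-All k g [] = Eventually-always k (λ _ → [])
Eventually-All k g (x ∷ xs) =
  Eventually-map k (λ _ (gx , gxs) → gx ∷ gxs) (Eventually-× k (g x) (Eventually-All k g xs))

Eventually-witness : ∀ k {G : (Fin k → ℤ) → Set} → Eventually k G → ∀ N →
                     Σ (Fin k → ℤ) λ a → ((i : Fin k) → N < a i) × G a
Eventually-witness zero g N = (λ ()) , (λ ()) , g
Eventually-witness (suc k) {G} (M , g) N = extend (Eventually-witness k (g x M<x) N)
  where
  x : ℤ
  x = sucℤ (M ⊔ N)
  ≤M⊔N⇒<x : ∀ {i} → i ℤ.≤ M ⊔ N → i < x
  ≤M⊔N⇒<x i≤ = ℤₚ.≤-<-trans i≤ (ℤₚ.suc[i]≤j⇒i<j ℤₚ.≤-refl)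
  M<x : M < x
  M<x = ≤M⊔N⇒<x (ℤₚ.i≤i⊔j M N)
  extend : Σ (Fin k → ℤ) (λ a → ((i : Fin k) → N < a i) × G (x ∷ᶠ a)) →
           Σ (Fin (suc k) → ℤ) (λ a → ((i : Fin (suc k)) → N < a i) × G a)
  extend (a , N<a , ga) = x ∷ᶠ a , (λ { zero → ≤M⊔N⇒<x (ℤₚ.i≤j⊔i M N) ; (suc i) → N<a i }) , ga

evalDense : List ℤ → ℤ → ℤ
evalDense [] x = + 0
evalDense (c ∷ cs) x = c + x * evalDense cs x

addDense : List ℤ → List ℤ → List ℤ
addDense [] ds = ds
addDense (c ∷ cs) [] = c ∷ cs
addDense (c ∷ cs) (d ∷ ds) = (c + d) ∷ addDense cs ds

monoDense : ℕ → ℤ → List ℤ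
monoDense zero z = z ∷ []
monoDense (suc e) z = + 0 ∷ monoDense e z

coeffDense : List ℤ → ℕ → ℤ
coeffDense [] j = + 0
coeffDense (c ∷ cs) zero = c
coeffDense (c ∷ cs) (suc j) = coeffDense cs j

evalDense-add : ∀ cs ds x → evalDense (addDense cs ds) x ≡ evalDense cs x + evalDense ds x
evalDense-add [] ds x = sym (ℤₚ.+-identityˡ _)
evalDense-add (c ∷ cs) [] x = sym (ℤₚ.+-identityʳ _)
evalDense-add (c ∷ cs) (d ∷ ds) x =
  trans (cong (λ w → (c + d) + x * w) (evalDense-add cs ds x))
        (regroup c d x (evalDense cs x) (evalDense ds x))
  where
  regroup : ∀ c d x u v → (c + d) + x * (u + v) ≡ (c + x * u) + (d + x * v)
  regroup = solve-∀

evalDense-mono : ∀ e z x → evalDense (monoDense e z) x ≡ z * x ^ e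
evalDense-mono zero z x = base z x
  where
  base : ∀ z x → z + x * + 0 ≡ z * + 1
  base = solve-∀
evalDense-mono (suc e) z x = trans (cong (λ w → + 0 + x * w) (evalDense-mono e z x)) (shift x z (x ^ e))
  where
  shift : ∀ x z y → + 0 + x * (z * y) ≡ z * (x * y)
  shift = solve-∀

coeffDense-add : ∀ cs ds j → coeffDense (addDense cs ds) j ≡ coeffDense cs j + coeffDense ds j
coeffDense-add [] ds j = sym (ℤₚ.+-identityˡ _)
coeffDense-add (c ∷ cs) [] j = sym (ℤₚ.+-identityʳ _)
coeffDense-add (c ∷ cs) (d ∷ ds) zero = refl
coeffDense-add (c ∷ cs) (d ∷ ds) (suc j) = coeffDense-add cs ds j

coeffDense-mono-≡ : ∀ e z → coeffDense (monoDense e z) e ≡ z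
coeffDense-mono-≡ zero z = refl
coeffDense-mono-≡ (suc e) z = coeffDense-mono-≡ e z

coeffDense-mono-≢ : ∀ {e j} z → e ≢ j → coeffDense (monoDense e z) j ≡ + 0
coeffDense-mono-≢ {zero} {zero} z e≢j = ⊥-elim (e≢j refl)
coeffDense-mono-≢ {zero} {suc j} z e≢j = refl
coeffDense-mono-≢ {suc e} {zero} z e≢j = refl
coeffDense-mono-≢ {suc e} {suc j} z e≢j = coeffDense-mono-≢ z (e≢j ∘ cong suc)

coeffDense-zeros : ∀ {cs} → All (_≡ + 0) cs → ∀ j → coeffDense cs j ≡ + 0
coeffDense-zeros [] j = refl
coeffDense-zeros (c≡0 ∷ _) zero = c≡0
coeffDense-zeros (_ ∷ cs≡0) (suc j) = coeffDense-zeros cs≡0 j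

evalDense-zeros : ∀ {cs} → All (_≡ + 0) cs → ∀ x → evalDense cs x ≡ + 0
evalDense-zeros [] x = refl
evalDense-zeros (c≡0 ∷ cs≡0) x =
  trans (cong₂ (λ c v → c + x * v) c≡0 (evalDense-zeros cs≡0 x)) (trans (ℤₚ.+-identityˡ _) (ℤₚ.*-zeroʳ x))

-- If c + x h = 0 then |c| = x |h| ≥ x.
c+x*h≢0 : ∀ c x h → + ∣ c ∣ < x → h ≢ + 0 → c + x * h ≢ + 0
c+x*h≢0 c (+ n) h (ℤ.+<+ ∣c∣<n) h≢0 c+nh≡0 = ℕₚ.<-irrefl refl (ℕₚ.<-≤-trans ∣c∣<n n≤∣c∣)
  where
  c≡-nh : c ≡ - (+ n * h)
  c≡-nh = ℤₚ.i-j≡0⇒i≡j c _ (trans (cong (_+_ c) (ℤₚ.neg-involutive (+ n * h))) c+nh≡0)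
  n≤∣c∣ : n ℕ.≤ ∣ c ∣
  n≤∣c∣ = begin
    n                 ≤⟨ ℕₚ.m≤m*n n ∣ h ∣ {{ℕ.≢-nonZero (h≢0 ∘ ℤₚ.∣i∣≡0⇒i≡0)}} ⟩
    n ℕ.* ∣ h ∣       ≡⟨ ℤₚ.abs-* (+ n) h ⟨
    ∣ + n * h ∣       ≡⟨ ℤₚ.∣-i∣≡∣i∣ (+ n * h) ⟨
    ∣ - (+ n * h) ∣   ≡⟨ cong ∣_∣ c≡-nh ⟨
    ∣ c ∣             ∎
    where open ℕₚ.≤-Reasoning

zeros-or-eventually-nonzero : ∀ cs → All (_≡ + 0) cs ⊎ ∃[ M ] ∀ x → M < x → evalDense cs x ≢ + 0
zeros-or-eventually-nonzero [] = inj₁ []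
zeros-or-eventually-nonzero (c ∷ cs) with zeros-or-eventually-nonzero cs
... | inj₂ (M , nonzero) = inj₂ (M ⊔ + ∣ c ∣ , λ x M⊔∣c∣<x →
  c+x*h≢0 c x _ (ℤₚ.≤-<-trans (ℤₚ.i≤j⊔i M _) M⊔∣c∣<x) (nonzero x (ℤₚ.≤-<-trans (ℤₚ.i≤i⊔j M _) M⊔∣c∣<x)))
... | inj₁ zeros with c ℤ.≟ + 0
...   | yes c≡0 = inj₁ (c≡0 ∷ zeros)
...   | no c≢0  = inj₂ (+ 0 , λ x _ → c≢0 ∘ trans (sym (evalDense-constant x)))
  where
  evalDense-constant : ∀ x → evalDense (c ∷ cs) x ≡ c
  evalDense-constant x = begin
    c + x * evalDense cs x  ≡⟨ cong (λ v → c + x * v) (evalDense-zeros zeros x) ⟩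
    c + x * + 0             ≡⟨ cong (_+_ c) (ℤₚ.*-zeroʳ x) ⟩
    c + + 0                 ≡⟨ ℤₚ.+-identityʳ c ⟩
    c                       ∎
    where open ≡-Reasoning

slice : ∀ {k} → ℤ → Poly (suc k) → Poly k
slice x = List.map (λ { (e ∷ m , z) → m , z * x ^ e })

column : ∀ {k} → Poly (suc k) → Monomial k → List ℤ
column [] m = []
column ((e ∷ m′ , z) ∷ P) m with m′ ≟ᵐ m
... | yes _ = addDense (monoDense e z) (column P m)
... | no _  = column P m

evalPoly-slice : ∀ {k} x (P : Poly (suc k)) a → evalPoly P (x ∷ᶠ a) ≡ evalPoly (slice x P) a
evalPoly-slice x [] a = refl
evalPoly-slice x ((e ∷ m , z) ∷ P) a =
  cong₂ _+_ (sym (ℤₚ.*-assoc z (x ^ e) (evalMon m a))) (evalPoly-slice x P a)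

coeff-slice : ∀ {k} x (P : Poly (suc k)) m → coeff (slice x P) m ≡ evalDense (column P m) x
coeff-slice x [] m = refl
coeff-slice x ((e ∷ m′ , z) ∷ P) m with m′ ≟ᵐ m
... | yes _ = sym (trans (evalDense-add (monoDense e z) _ x)
                        (cong₂ _+_ (evalDense-mono e z x) (sym (coeff-slice x P m))))
... | no _  = coeff-slice x P m

coeffDense-column : ∀ {k} (P : Poly (suc k)) m j → coeffDense (column P m) j ≡ coeff P (j ∷ m)
coeffDense-column [] m j = refl
coeffDense-column ((e ∷ m′ , z) ∷ P) m j with m′ ≟ᵐ m | (e ∷ m′) ≟ᵐ (j ∷ m)
... | yes _ | yes e∷m′≡j∷m = trans (coeffDense-add (monoDense e z) _ j) (cong₂ _+_
      (subst (λ j′ → coeffDense (monoDense e z) j′ ≡ z) (∷-injectiveˡ e∷m′≡j∷m) (coeffDense-mono-≡ e z))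
      (coeffDense-column P m j))
... | yes m′≡m | no e∷m′≢j∷m = trans (coeffDense-add (monoDense e z) _ j) (trans (cong₂ _+_
      (coeffDense-mono-≢ z (λ e≡j → e∷m′≢j∷m (cong₂ _∷_ e≡j m′≡m))) (coeffDense-column P m j))
      (ℤₚ.+-identityˡ _))
... | no m′≢m | yes e∷m′≡j∷m = ⊥-elim (m′≢m (∷-injectiveʳ e∷m′≡j∷m))
... | no _ | no _ = coeffDense-column P m j

evalPoly-nullary : (P : Poly 0) → evalPoly P (λ ()) ≡ coeff P []
evalPoly-nullary [] = refl
evalPoly-nullary (([] , z) ∷ P) with [] ≟ᵐ []
... | yes _   = cong₂ _+_ (ℤₚ.*-identityʳ z) (evalPoly-nullary P)
... | no []≢[] = ⊥-elim ([]≢[] refl)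

-- Viewed as a polynomial in the first variable x, the coefficient of the remaining monomial m is nonzero,
-- so it stays nonzero in slice x P for every large enough x.
eventually-nonzero : ∀ k (P : Poly k) m → coeff P m ≢ + 0 → Eventually k (λ a → evalPoly P a ≢ + 0)
eventually-nonzero zero P [] P[]≢0 = P[]≢0 ∘ trans (sym (evalPoly-nullary P))
eventually-nonzero (suc k) P (j ∷ m) Pjm≢0 with zeros-or-eventually-nonzero (column P m)
... | inj₁ zeros = ⊥-elim (Pjm≢0 (trans (sym (coeffDense-column P m j)) (coeffDense-zeros zeros j)))
... | inj₂ (M , nonzero) = M , λ x M<x →
  Eventually-map k (λ a P[x∷a]≢0 → P[x∷a]≢0 ∘ trans (sym (evalPoly-slice x P a)))
    (eventually-nonzero k (slice x P) m (nonzero x M<x ∘ trans (sym (coeff-slice x P m))))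

eventually-≢ : ∀ k (p q : Poly k) → p ≉ₚ q → Eventually k (λ a → evalPoly p a ≢ evalPoly q a)
eventually-≢ k p q (m , pm≢qm) =
  Eventually-map k (λ a p-q≢0 → p-q≢0 ∘ trans (evalPoly-subₚ p q a) ∘ ℤₚ.i≡j⇒i-j≡0)
    (eventually-nonzero k (p -ₚ q) m (pm≢qm ∘ ℤₚ.i-j≡0⇒i≡j _ _ ∘ trans (sym (coeff-subₚ p q m))))

-- Trees

≈ₜ-refl : ∀ {c k} {t : Tree c k} → t ≈ₜ t
≈ₜ-refl {t = node _} = node≈ ≈-refl

≈ₜ-sym : ∀ {c k} {s t : Tree c k} → s ≈ₜ t → t ≈ₜ s
≈ₜ-sym (node≈ l≈l′) = node≈ (≈-sym l≈l′)

≈ₜ-trans : ∀ {c k} {s t u : Tree c k} → s ≈ₜ t → t ≈ₜ u → s ≈ₜ u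
≈ₜ-trans (node≈ l≈l′) (node≈ l′≈l″) = node≈ (≈-trans l≈l′ l′≈l″)

coeff-const : ∀ z → coeff (const z) [] ≡ z
coeff-const z with [] ≟ᵐ []
... | yes _    = ℤₚ.+-identityʳ z
... | no []≢[] = ⊥-elim ([]≢[] refl)

module _ {c k : ℕ} (a : Fin k → ℤ) where

  evalTree-cong : {s t : Tree c k} → s ≈ₜ t → evalTree s a ≈ₜ evalTree t a
  evalList-cong : {l l′ : List (Fin c × Poly k × Tree c k)} → l ≈ₗ l′ → evalList l a ≈ₗ evalList l′ a

  evalTree-cong (node≈ l≈l′) = node≈ (evalList-cong l≈l′)

  evalList-cong ≈-refl = ≈-refl
  evalList-cong (≈-sym l≈l′) = ≈-sym (evalList-cong l≈l′)
  evalList-cong (≈-trans l≈l′ l′≈l″) = ≈-trans (evalList-cong l≈l′) (evalList-cong l′≈l″)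
  evalList-cong (≈-cons {p = p} {p′} p≈p′ u≈u′ l≈l′) =
    ≈-cons (λ { [] → cong (λ z → coeff (const z) []) (evalPoly-cong {p = p} {p′} p≈p′ a) })
           (evalTree-cong u≈u′) (evalList-cong l≈l′)
  evalList-cong ≈-swap = ≈-swap
  evalList-cong (≈-merge {p = p} {q}) = ≈-trans ≈-merge (≈-cons const-+ₚ ≈ₜ-refl ≈-refl)
    where
    const-+ₚ : (const (evalPoly p a) +ₚ const (evalPoly q a)) ≈ₚ const (evalPoly (p +ₚ q) a)
    const-+ₚ [] = begin
      coeff (const (evalPoly p a) +ₚ const (evalPoly q a)) []
        ≡⟨ coeff-+ₚ (const (evalPoly p a)) (const (evalPoly q a)) [] ⟩
      coeff (const (evalPoly p a)) [] + coeff (const (evalPoly q a)) []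
        ≡⟨ cong₂ _+_ (coeff-const (evalPoly p a)) (coeff-const (evalPoly q a)) ⟩
      evalPoly p a + evalPoly q a                             ≡⟨ evalPoly-+ₚ p q a ⟨
      evalPoly (p +ₚ q) a                                     ≡⟨ coeff-const (evalPoly (p +ₚ q) a) ⟨
      coeff (const (evalPoly (p +ₚ q) a)) []                  ∎
      where open ≡-Reasoning
  evalList-cong ≈-zero = ≈-trans (≈-cons (λ { [] → coeff-const (+ 0) }) ≈ₜ-refl ≈-refl) ≈-zero

Separated : ∀ {c k} → Tree c k → Tree c k → Set
Separated {k = k} s t = Eventually k (λ a → ¬ evalTree s a ≈ₜ evalTree t a)

Separated⇒≉ : ∀ {c k} {s t : Tree c k} → Separated s t → ¬ s ≈ₜ t
Separated⇒≉ {k = k} separated s≈t =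
  let a , _ , s[a]≉t[a] = Eventually-witness k separated (+ 0) in s[a]≉t[a] (evalTree-cong a s≈t)

-- Multiplicity is a relation rather than a function because ≈ₜ is not known to be decidable.
module Count {c k : ℕ} (σ : Fin c) (w : Tree c k) (m : Monomial k) where

  Term : Set
  Term = Fin c × Poly k × Tree c k

  data Contribution : Term → ℤ → Set where
    counted   : ∀ {σ′ p v} → σ′ ≡ σ → v ≈ₜ w → Contribution (σ′ , p , v) (coeff p m)
    uncounted : ∀ {σ′ p v} → ¬ (σ′ ≡ σ × v ≈ₜ w) → Contribution (σ′ , p , v) (+ 0)

  data Multiplicity : List Term → ℤ → Set where
    []  : Multiplicity [] (+ 0)
    _∷_ : ∀ {x i l j} → Contribution x i → Multiplicity l j → Multiplicity (x ∷ l) (i + j)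

  Contribution-functional : ∀ {x i j} → Contribution x i → Contribution x j → i ≡ j
  Contribution-functional (counted _ _) (counted _ _) = refl
  Contribution-functional (counted σ′≡σ v≈w) (uncounted ≉) = ⊥-elim (≉ (σ′≡σ , v≈w))
  Contribution-functional (uncounted ≉) (counted σ′≡σ v≈w) = ⊥-elim (≉ (σ′≡σ , v≈w))
  Contribution-functional (uncounted _) (uncounted _) = refl

  Multiplicity-functional : ∀ {l i j} → Multiplicity l i → Multiplicity l j → i ≡ j
  Multiplicity-functional [] [] = refl
  Multiplicity-functional (C ∷ M) (C′ ∷ M′) =
    cong₂ _+_ (Contribution-functional C C′) (Multiplicity-functional M M′)

  Contribution-cong : ∀ {σ′ p p′ u u′ i} → p ≈ₚ p′ → u ≈ₜ u′ →
                      Contribution (σ′ , p , u) i → Contribution (σ′ , p′ , u′) i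
  Contribution-cong p≈p′ u≈u′ (counted σ′≡σ u≈w) =
    subst (Contribution _) (sym (p≈p′ m)) (counted σ′≡σ (≈ₜ-trans (≈ₜ-sym u≈u′) u≈w))
  Contribution-cong p≈p′ u≈u′ (uncounted ≉) = uncounted (λ (σ′≡σ , u′≈w) → ≉ (σ′≡σ , ≈ₜ-trans u≈u′ u′≈w))

  Contribution-0ₚ : ∀ {σ′ u i} → Contribution (σ′ , 0ₚ , u) i → i ≡ + 0
  Contribution-0ₚ (counted _ _) = refl
  Contribution-0ₚ (uncounted _) = refl

  Contribution-+ₚ : ∀ {σ′ p q u i j} → Contribution (σ′ , p , u) i → Contribution (σ′ , q , u) j →
                    Contribution (σ′ , p +ₚ q , u) (i + j)
  Contribution-+ₚ {p = p} {q} (counted σ′≡σ u≈w) (counted _ _) =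
    subst (Contribution _) (coeff-+ₚ p q m) (counted σ′≡σ u≈w)
  Contribution-+ₚ (counted σ′≡σ u≈w) (uncounted ≉) = ⊥-elim (≉ (σ′≡σ , u≈w))
  Contribution-+ₚ (uncounted ≉) (counted σ′≡σ u≈w) = ⊥-elim (≉ (σ′≡σ , u≈w))
  Contribution-+ₚ (uncounted ≉) (uncounted _) = uncounted ≉

  Contribution-split : ∀ {σ′ p q u i} → Contribution (σ′ , p +ₚ q , u) i →
                       ∃[ i₁ ] ∃[ i₂ ] Contribution (σ′ , p , u) i₁ × Contribution (σ′ , q , u) i₂ × i ≡ i₁ + i₂
  Contribution-split {p = p} {q} (counted σ′≡σ u≈w) =
    _ , _ , counted σ′≡σ u≈w , counted σ′≡σ u≈w , coeff-+ₚ p q m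
  Contribution-split (uncounted ≉) = _ , _ , uncounted ≉ , uncounted ≉ , refl

  open RawMonad (¬¬-Monad {0ℓ})

  Preserves : List Term → List Term → Set
  Preserves l l′ = ∀ {i} → Multiplicity l i → ¬ ¬ Multiplicity l′ i

  swap-preserves : ∀ {x y l} → Preserves (x ∷ y ∷ l) (y ∷ x ∷ l)
  swap-preserves (_∷_ {i = i} Cx (_∷_ {i = j} {j = r} Cy M)) =
    pure (subst (Multiplicity _) (exchange i j r) (Cy ∷ (Cx ∷ M)))
    where
    exchange : ∀ i j r → j + (i + r) ≡ i + (j + r)
    exchange = solve-∀

  merge-preserves : ∀ {σ′ p q u l} → Preserves ((σ′ , p , u) ∷ (σ′ , q , u) ∷ l) ((σ′ , p +ₚ q , u) ∷ l)
  merge-preserves (_∷_ {i = i} Cp (_∷_ {i = j} {j = r} Cq M)) =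
    pure (subst (Multiplicity _) (ℤₚ.+-assoc i j r) (Contribution-+ₚ Cp Cq ∷ M))

  split-preserves : ∀ {σ′ p q u l} → Preserves ((σ′ , p +ₚ q , u) ∷ l) ((σ′ , p , u) ∷ (σ′ , q , u) ∷ l)
  split-preserves (_∷_ {j = r} C M) with Contribution-split C
  ... | i , j , Cp , Cq , refl = pure (subst (Multiplicity _) (sym (ℤₚ.+-assoc i j r)) (Cp ∷ (Cq ∷ M)))

  drop-preserves : ∀ {σ′ u l} → Preserves ((σ′ , 0ₚ , u) ∷ l) l
  drop-preserves (_∷_ {j = r} C M) rewrite Contribution-0ₚ C =
    pure (subst (Multiplicity _) (sym (ℤₚ.+-identityˡ r)) M)

  -- The only use of excluded middle, harmless because the goal is a negation.
  insert-preserves : ∀ {σ′ u l} → Preserves l ((σ′ , 0ₚ , u) ∷ l)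
  insert-preserves {σ′} {u} {i = r} M = do
    counted? ← ¬¬-excluded-middle {A = σ′ ≡ σ × u ≈ₜ w}
    pure (subst (Multiplicity _) (ℤₚ.+-identityˡ r) (contribution counted? ∷ M))
    where
    contribution : Dec (σ′ ≡ σ × u ≈ₜ w) → Contribution (σ′ , 0ₚ , u) (+ 0)
    contribution (yes (σ′≡σ , u≈w)) = counted σ′≡σ u≈w
    contribution (no ≉) = uncounted ≉

  ≈ₗ-preserves : ∀ {l l′} → l ≈ₗ l′ → Preserves l l′ × Preserves l′ l
  ≈ₗ-preserves ≈-refl = pure , pure
  ≈ₗ-preserves (≈-sym l≈l′) = let (to , from) = ≈ₗ-preserves l≈l′ in from , to
  ≈ₗ-preserves (≈-trans l≈l′ l′≈l″) =
    let (to₁ , from₁) = ≈ₗ-preserves l≈l′ ; (to₂ , from₂) = ≈ₗ-preserves l′≈l″ in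
    (λ M → to₁ M >>= to₂) , (λ M → from₂ M >>= from₁)
  ≈ₗ-preserves (≈-cons p≈p′ u≈u′ l≈l′) = let (to , from) = ≈ₗ-preserves l≈l′ in
    (λ { (C ∷ M) → (Contribution-cong p≈p′ u≈u′ C ∷_) <$> to M }) ,
    (λ { (C ∷ M) → (Contribution-cong (sym ∘ p≈p′) (≈ₜ-sym u≈u′) C ∷_) <$> from M })
  ≈ₗ-preserves ≈-swap = swap-preserves , swap-preserves
  ≈ₗ-preserves ≈-merge = merge-preserves , split-preserves
  ≈ₗ-preserves ≈-zero = drop-preserves , insert-preserves

  ≈ₗ⇒Multiplicity-≡ : ∀ {l l′ i j} → l ≈ₗ l′ → Multiplicity l i → Multiplicity l′ j → i ≡ j
  ≈ₗ⇒Multiplicity-≡ {i = i} {j} l≈l′ M M′ =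
    decidable-stable (i ℤ.≟ j)
      (λ i≢j → proj₁ (≈ₗ-preserves l≈l′) M (λ M″ → i≢j (Multiplicity-functional M″ M′)))

-- Deciding equivalence

-- The subtrees of terms live in a type D on which equivalence is already decided; in the induction
-- on height, D consists of the trees of smaller height.
module Compare {c k : ℕ} {D : Set} (⌞_⌟ : D → Tree c k) where

  Term : Set
  Term = Fin c × Poly k × D

  colour : Term → Fin c
  colour = proj₁

  tree : Term → Tree c k
  tree (_ , _ , v) = ⌞ v ⌟

  ⌊_⌋ : List Term → List (Fin c × Poly k × Tree c k)
  ⌊_⌋ = List.map (λ (σ , p , v) → σ , p , ⌞ v ⌟)

  _≅_ : Term → Term → Set
  x ≅ y = colour x ≡ colour y × tree x ≈ₜ tree y

  ≅-sym : ∀ {x y} → x ≅ y → y ≅ x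
  ≅-sym (σ≡σ′ , u≈u′) = sym σ≡σ′ , ≈ₜ-sym u≈u′

  ≅-trans : ∀ {x y z} → x ≅ y → y ≅ z → x ≅ z
  ≅-trans (σ≡σ′ , u≈u′) (σ′≡σ″ , u′≈u″) = trans σ≡σ′ σ′≡σ″ , ≈ₜ-trans u≈u′ u′≈u″

  data Apart (x y : Term) : Set where
    colours-differ   : colour x ≢ colour y → Apart x y
    trees-separated  : Separated (tree x) (tree y) → Apart x y

  Apart⇒≇ : ∀ {x y} → Apart x y → ¬ x ≅ y
  Apart⇒≇ (colours-differ σ≢σ′) (σ≡σ′ , _) = σ≢σ′ σ≡σ′
  Apart⇒≇ (trees-separated separated) (_ , u≈u′) = Separated⇒≉ separated u≈u′

  module _ (compare : ∀ v w → ⌞ v ⌟ ≈ₜ ⌞ w ⌟ ⊎ Separated ⌞ v ⌟ ⌞ w ⌟) where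

    data Match (x y : Term) : Set where
      matching : x ≅ y → Match x y
      apart    : Apart x y → Match x y

    match? : ∀ x y → Match x y
    match? (σ , _ , v) (σ′ , _ , v′) with σ Finₚ.≟ σ′ | compare v v′
    ... | yes σ≡σ′ | inj₁ v≈v′     = matching (σ≡σ′ , v≈v′)
    ... | yes _    | inj₂ separated = apart (trees-separated separated)
    ... | no σ≢σ′  | _              = apart (colours-differ σ≢σ′)

    share : ∀ {x y} → Match x y → Poly k
    share {y = _ , p , _} (matching _) = p
    share (apart _) = 0ₚ

    keep : ∀ {x y} → Match x y → List Term → List Term
    keep (matching _) r = r
    keep {y = y} (apart _) r = y ∷ r

    -- The coefficient of the class of x in l, and the terms of l outside that class.
    weight : Term → List Term → Poly k
    weight x [] = 0ₚ
    weight x (y ∷ l) = share (match? x y) +ₚ weight x l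

    others : Term → List Term → List Term
    others x [] = []
    others x (y ∷ l) = keep (match? x y) (others x l)

    gather : ∀ x l → ⌊ l ⌋ ≈ₗ (colour x , weight x l , tree x) ∷ ⌊ others x l ⌋
    gather x [] = ≈-sym ≈-zero
    gather x (y ∷ l) with match? x y
    gather (σ , _) ((σ , _) ∷ l) | matching (refl , x≈y) =
      ≈-trans (≈-cons (λ _ → refl) (≈ₜ-sym x≈y) (gather _ l)) ≈-merge
    gather x (y ∷ l) | apart _ = ≈-trans (≈-cons (λ _ → refl) ≈ₜ-refl (gather x l)) ≈-swap

    others-length : ∀ x l → length (others x l) ℕ.≤ length l
    others-length x [] = ℕ.z≤n
    others-length x (y ∷ l) with match? x y
    ... | matching _ = ℕₚ.m≤n⇒m≤1+n (others-length x l)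
    ... | apart _    = ℕ.s≤s (others-length x l)

    others-self-length : ∀ x l → length (others x (x ∷ l)) ℕ.≤ length l
    others-self-length x l with match? x x
    ... | matching _   = others-length x l
    ... | apart x≇x = ⊥-elim (Apart⇒≇ x≇x (refl , ≈ₜ-refl))

    weight-others-≅ : ∀ {x y} → x ≅ y → ∀ l → weight y (others x l) ≡ 0ₚ
    weight-others-≅ x≅y [] = refl
    weight-others-≅ {x} {y} x≅y (z ∷ l) with match? x z
    ... | matching _ = weight-others-≅ x≅y l
    ... | apart x≇z with match? y z
    ...   | matching y≅z = ⊥-elim (Apart⇒≇ x≇z (≅-trans {x} {y} {z} x≅y y≅z))
    ...   | apart _      = weight-others-≅ x≅y l

    weight-others-≇ : ∀ {x y} → ¬ x ≅ y → ∀ l → weight y (others x l) ≡ weight y l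
    weight-others-≇ x≇y [] = refl
    weight-others-≇ {x} {y} x≇y (z ∷ l) with match? x z
    ... | apart _ = cong (share (match? y z) +ₚ_) (weight-others-≇ x≇y l)
    ... | matching x≅z with match? y z
    ...   | matching y≅z = ⊥-elim (x≇y (≅-trans {x} {z} {y} x≅z (≅-sym {y} {z} y≅z)))
    ...   | apart _      = weight-others-≇ x≇y l

    weight-≉-others : ∀ x y l l′ → weight y (others x l) ≉ₚ weight y (others x l′) →
                      weight y l ≉ₚ weight y l′
    weight-≉-others x y l l′ (m , differ) with match? x y
    ... | matching x≅y = ⊥-elim (differ (cong (λ p → coeff p m)
                            (trans (weight-others-≅ x≅y l) (sym (weight-others-≅ x≅y l′)))))
    ... | apart x≇y = m , subst₂ (λ p q → ¬ coeff p m ≡ coeff q m)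
                            (weight-others-≇ (Apart⇒≇ x≇y) l) (weight-others-≇ (Apart⇒≇ x≇y) l′) differ

    compareLists : ∀ n l l′ → length l ℕ.+ length l′ ℕ.≤ n →
                   ⌊ l ⌋ ≈ₗ ⌊ l′ ⌋ ⊎ ∃[ x ] weight x l ≉ₚ weight x l′
    compareAtPivot : ∀ x n l l′ → length (others x l) ℕ.+ length (others x l′) ℕ.≤ n →
                ⌊ l ⌋ ≈ₗ ⌊ l′ ⌋ ⊎ ∃[ x ] weight x l ≉ₚ weight x l′

    compareLists n [] [] _ = inj₁ ≈-refl
    compareLists (suc n) (x ∷ l) l′ (ℕ.s≤s size≤n) =
      compareAtPivot x n (x ∷ l) l′
        (ℕₚ.≤-trans (ℕₚ.+-mono-≤ (others-self-length x l) (others-length x l′)) size≤n)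
    compareLists (suc n) [] (x ∷ l′) (ℕ.s≤s size≤n) =
      compareAtPivot x n [] (x ∷ l′) (ℕₚ.≤-trans (others-self-length x l′) size≤n)

    compareAtPivot x n l l′ size≤n with ≈ₚ-or-≉ₚ (weight x l) (weight x l′)
    ... | inj₂ weights≉ = inj₂ (x , weights≉)
    ... | inj₁ weights≈ with compareLists n (others x l) (others x l′) size≤n
    ...   | inj₁ others≈ =
      inj₁ (≈-trans (gather x l) (≈-trans (≈-cons weights≈ ≈ₜ-refl others≈) (≈-sym (gather x l′))))
    ...   | inj₂ (y , weights≉) = inj₂ (y , weight-≉-others x y l l′ weights≉)

    StaysApart : ∀ {x y} → Match x y → (Fin k → ℤ) → Set
    StaysApart (matching _) a = ⊤
    StaysApart {x} {y} (apart _) a = ¬ (colour y ≡ colour x × evalTree (tree y) a ≈ₜ evalTree (tree x) a)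

    eventually-StaysApart : ∀ {x y} (μ : Match x y) → Eventually k (StaysApart μ)
    eventually-StaysApart (matching _) = Eventually-always k (λ _ → tt)
    eventually-StaysApart (apart (colours-differ σ≢σ′)) =
      Eventually-always k (λ _ (σ′≡σ , _) → σ≢σ′ (sym σ′≡σ))
    eventually-StaysApart (apart (trees-separated separated)) =
      Eventually-map k (λ _ u≉u′ (_ , u′≈u) → u≉u′ (≈ₜ-sym u′≈u)) separated

    module _ (x : Term) (a : Fin k → ℤ) where
      open Count (colour x) (evalTree (tree x) a) []

      Multiplicity-eval : ∀ l → All (λ y → StaysApart (match? x y) a) l →
                          Multiplicity (evalList ⌊ l ⌋ a) (evalPoly (weight x l) a)
      Multiplicity-eval [] [] = []
      Multiplicity-eval (y ∷ l) (stays ∷ staysₗ) with match? x y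
      Multiplicity-eval ((_ , p , _) ∷ l) (_ ∷ staysₗ) | matching (σ≡σ′ , u≈u′) =
        subst (Multiplicity _) (trans (cong (_+ evalPoly (weight x l) a) (coeff-const (evalPoly p a)))
                                      (sym (evalPoly-+ₚ p (weight x l) a)))
          (counted (sym σ≡σ′) (evalTree-cong a (≈ₜ-sym u≈u′)) ∷ Multiplicity-eval l staysₗ)
      Multiplicity-eval (y ∷ l) (stays ∷ staysₗ) | apart _ =
        subst (Multiplicity _) (ℤₚ.+-identityˡ _) (uncounted stays ∷ Multiplicity-eval l staysₗ)

    separate : ∀ {x} l l′ → weight x l ≉ₚ weight x l′ → Separated (node ⌊ l ⌋) (node ⌊ l′ ⌋)
    separate {x} l l′ weights≉ =
      Eventually-map k inequivalent
        (Eventually-× k (eventually-≢ k (weight x l) (weight x l′) weights≉)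
                        (Eventually-× k (staysApart l) (staysApart l′)))
      where
      staysApart : ∀ l → Eventually k (λ a → All (λ y → StaysApart (match? x y) a) l)
      staysApart = Eventually-All k (λ y → eventually-StaysApart (match? x y))
      inequivalent : ∀ a → evalPoly (weight x l) a ≢ evalPoly (weight x l′) a ×
                           All (λ y → StaysApart (match? x y) a) l × All (λ y → StaysApart (match? x y) a) l′ →
                           ¬ node (evalList ⌊ l ⌋ a) ≈ₜ node (evalList ⌊ l′ ⌋ a)
      inequivalent a (weights≢ , stays , stays′) (node≈ l≈l′) =
        weights≢ (Count.≈ₗ⇒Multiplicity-≡ (colour x) (evalTree (tree x) a) [] l≈l′
                   (Multiplicity-eval x a l stays) (Multiplicity-eval x a l′ stays′))

    compare-nodes : ∀ l l′ → node ⌊ l ⌋ ≈ₜ node ⌊ l′ ⌋ ⊎ Separated (node ⌊ l ⌋) (node ⌊ l′ ⌋)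
    compare-nodes l l′ with compareLists _ l l′ ℕₚ.≤-refl
    ... | inj₁ l≈l′ = inj₁ (node≈ l≈l′)
    ... | inj₂ (_ , weights≉) = inj₂ (separate l l′ weights≉)

height : ∀ {c k} → Tree c k → ℕ
heights : ∀ {c k} → List (Fin c × Poly k × Tree c k) → ℕ
height (node l) = suc (heights l)
heights [] = 0
heights ((_ , _ , u) ∷ l) = height u ℕ.⊔ heights l

module _ {c k : ℕ} (n : ℕ) where

  BoundedTree : Set
  BoundedTree = Σ (Tree c k) (λ u → height u ℕ.≤ n)

  open Compare {D = BoundedTree} proj₁ using (⌊_⌋)

  decorate : (l : List (Fin c × Poly k × Tree c k)) → heights l ℕ.≤ n → List (Fin c × Poly k × BoundedTree)
  decorate [] _ = []
  decorate ((σ , p , u) ∷ l) hl≤n =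
    (σ , p , u , ℕₚ.m⊔n≤o⇒m≤o _ _ hl≤n) ∷ decorate l (ℕₚ.m⊔n≤o⇒n≤o (height u) _ hl≤n)

  ⌊decorate⌋ : ∀ l hl≤n → ⌊ decorate l hl≤n ⌋ ≡ l
  ⌊decorate⌋ [] _ = refl
  ⌊decorate⌋ ((σ , p , u) ∷ l) hl≤n = cong ((σ , p , u) ∷_) (⌊decorate⌋ l _)

decide : ∀ {c k} n (s t : Tree c k) → height s ℕ.≤ n → height t ℕ.≤ n → s ≈ₜ t ⊎ Separated s t
decide {c} {k} (suc n) (node l) (node l′) (ℕ.s≤s hl≤n) (ℕ.s≤s hl′≤n) =
  subst₂ (λ l l′ → node l ≈ₜ node l′ ⊎ Separated (node l) (node l′))
         (⌊decorate⌋ n l hl≤n) (⌊decorate⌋ n l′ hl′≤n)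
         (compare-nodes (λ (v , hv≤n) (w , hw≤n) → decide n v w hv≤n hw≤n)
                        (decorate n l hl≤n) (decorate n l′ hl′≤n))
  where open Compare {D = BoundedTree {c} {k} n} proj₁

lemma5p8 : (c k : ℕ) (s t : Tree c k) → ¬ (s ≈ₜ t) →
    (N : ℤ) → Σ (Fin k → ℤ) (λ a → ((i : Fin k) → N < a i) × ¬ (evalTree s a ≈ₜ evalTree t a))
lemma5p8 c k s t s≉t N with decide _ s t (ℕₚ.m≤m⊔n (height s) (height t)) (ℕₚ.m≤n⊔m (height s) (height t))
... | inj₁ s≈t = ⊥-elim (s≉t s≈t)
... | inj₂ separated = Eventually-witness k separated N
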